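{- The modal logic $\Re$ is decidable: there is an algorithm that, given a formula $\phi$ of $\mathcal L$, decides whether $\vdash_\Re\phi$.
   Context: The language $\mathcal L$: formulas built from propositional variables and $\bot$ using $\rightarrow$ and a binary modality $\rhd$; $\wedge,\vee,\neg,\top$ defined as usual. The logic $\Re$: classical propositional logic in $\mathcal L$ plus axioms A1: $\phi\rhd\psi\rightarrow(\chi\rhd\psi\rightarrow(\phi\vee\chi)\rhd\psi)$, A2: $\bot\rhd\phi$, A3: $\phi\rhd\top$, with inference rules Modus Ponens and M: from $\phi_1\rightarrow\phi_2$ and $\psi_1\rightarrow\psi_2$ infer $\phi_2\rhd\psi_1\rightarrow\phi_1\rhd\psi_2$. -}

module Defs where

open import Data.Nat using (ℕ)

infixr 6 _⇒_
infix 7 _▷_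

data Fm : Set where
  var : ℕ → Fm
  ⊥'  : Fm
  _⇒_ : Fm → Fm → Fm
  _▷_ : Fm → Fm → Fm

¬' : Fm → Fm
¬' φ = φ ⇒ ⊥'

⊤' : Fm
⊤' = ¬' ⊥'

_∨'_ : Fm → Fm → Fm
φ ∨' ψ = ¬' φ ⇒ ψ

_∧'_ : Fm → Fm → Fm
φ ∧' ψ = ¬' (φ ⇒ ¬' ψ)

-- Classical propositional logic is given by a standard complete Hilbert
-- axiomatisation for {→, ⊥} (K, S, double negation elimination), with all
-- instances over the full language L.
data ⊢_ : Fm → Set where
  ax-K  : ∀ φ ψ → ⊢ (φ ⇒ (ψ ⇒ φ))
  ax-S  : ∀ φ ψ χ → ⊢ ((φ ⇒ (ψ ⇒ χ)) ⇒ ((φ ⇒ ψ) ⇒ (φ ⇒ χ)))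
  ax-DN : ∀ φ → ⊢ (¬' (¬' φ) ⇒ φ)
  ax-A1 : ∀ φ ψ χ → ⊢ ((φ ▷ ψ) ⇒ ((χ ▷ ψ) ⇒ ((φ ∨' χ) ▷ ψ)))
  ax-A2 : ∀ φ → ⊢ (⊥' ▷ φ)
  ax-A3 : ∀ φ → ⊢ (φ ▷ ⊤')
  mp    : ∀ {φ ψ} → ⊢ (φ ⇒ ψ) → ⊢ φ → ⊢ ψ
  rule-M : ∀ {φ₁ φ₂ ψ₁ ψ₂} → ⊢ (φ₁ ⇒ φ₂) → ⊢ (ψ₁ ⇒ ψ₂)
         → ⊢ ((φ₂ ▷ ψ₁) ⇒ (φ₁ ▷ ψ₂))

{-# OPTIONS --safe #-}
-- ℜ is sound for finite models whose worlds declare finitely many formulas φ′ ▷ ψ′, and each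
-- formula is provable or refuted in such a model, by recursion on modal depth.  Split φ on the
-- truth values of its atoms (variables and ▷-formulas): under each case Γ, Kalmár's lemma gives
-- Γ ⊢ φ or Γ ⊢ ¬φ, and in the latter case Γ is either inconsistent or satisfied by a world
-- declaring the ▷-atoms that Γ asserts.  For ¬(φ ▷ ψ) in Γ, decide ψ′ ⇒ ψ for each declared
-- φ′ ▷ ψ′; by M and A1 the provable ones give δ ▷ ψ, δ the disjunction of their φ′.  Then decide
-- φ ⇒ δ: if it is provable, M gives φ ▷ ψ and Γ is inconsistent; otherwise its countermodel and
-- the countermodels of the unprovable ψ′ ⇒ ψ are successors falsifying φ ▷ ψ.  All formulas
-- decided here have lower modal depth than φ.
module Submission where

open import Defs
open import Relation.Nullary using (Dec; yes; no; ¬_)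
open import Relation.Nullary.Decidable using (⌊_⌋; map′; fromWitness; decidable-stable; _×-dec_; _→-dec_)
open import Data.Bool using (Bool; T)
open import Data.Bool.Properties using (T?)
open import Data.Empty using (⊥; ⊥-elim)
open import Data.Fin using (Fin)
open import Data.Fin.Properties using (all?)
open import Data.List using (List; []; _∷_; [_]; _++_; lookup)
open import Data.List.Membership.Propositional using (_∈_; find)
open import Data.List.Membership.Propositional.Properties using (∈-++⁺ˡ; ∈-++⁺ʳ; ∈-++⁻)
open import Data.List.Relation.Unary.All as All using (All; []; _∷_; lookupAny)
open import Data.List.Relation.Unary.All.Properties using (++⁻ˡ; ++⁻ʳ)
open import Data.List.Relation.Unary.Any as Any using (Any; here; there; any?)
open import Data.List.Relation.Unary.Any.Properties using (lookup-index)
open import Data.Nat using (ℕ; suc; _⊔_; _≤_; _<_; s≤s; z≤n)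
open import Data.Nat.Properties using (_≟_; ≤-refl; <-≤-trans; m≤m⊔n; m≤n⊔m; ⊔-lub)
open import Data.Product as Product using (∃; _×_; _,_)
open import Data.Sum as Sum using (_⊎_; inj₁; inj₂)
open import Function using (id; _∘_)
open import Relation.Binary.PropositionalEquality using (_≡_; refl; sym; cong)

variable
  m n k : ℕ
  c φ ψ χ φ₁ φ₂ ψ₁ ψ₂ : Fm
  Γ : List Fm

-- A world is a valuation, a finite family of successors and a list of declared pairs (φ′ , ψ′).
-- φ ▷ ψ holds if every φ-successor satisfies φ′ for a declared pair whose ψ′ implies ψ at every
-- successor.  (⊤' , ⊤') is always declared, which validates A3.
data World : Set where
  node : (ℕ → Bool) → (Fin k → World) → List (Fm × Fm) → World

infix 4 _⊨_ _⊨?_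

_⊨_ : World → Fm → Set
w ⊨ ⊥' = ⊥
w ⊨ (φ ⇒ ψ) = w ⊨ φ → w ⊨ ψ
node val succ decl ⊨ var p = T (val p)
node val succ decl ⊨ (φ ▷ ψ) =
  ∀ i → succ i ⊨ φ →
  Any (λ (φ′ , ψ′) → succ i ⊨ φ′ × (∀ j → succ j ⊨ ψ′ → succ j ⊨ ψ)) ((⊤' , ⊤') ∷ decl)

_⊨?_ : ∀ w φ → Dec (w ⊨ φ)
w ⊨? ⊥' = no λ ()
w ⊨? (φ ⇒ ψ) = (w ⊨? φ) →-dec (w ⊨? ψ)
node val succ decl ⊨? var p = T? (val p)
node val succ decl ⊨? (φ ▷ ψ) =
  all? λ i → (succ i ⊨? φ) →-dec
  any? (λ (φ′ , ψ′) → (succ i ⊨? φ′) ×-dec all? λ j → (succ j ⊨? ψ′) →-dec (succ j ⊨? ψ))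
       ((⊤' , ⊤') ∷ decl)

sound : ⊢ φ → ∀ w → w ⊨ φ
sound (ax-K φ ψ) w = λ x _ → x
sound (ax-S φ ψ χ) w = λ f g x → f x (g x)
sound (ax-DN φ) w = decidable-stable (w ⊨? φ)
sound (ax-A1 φ ψ χ) (node val succ decl) φ▷ψ χ▷ψ i i⊨φ∨χ with succ i ⊨? φ
... | yes i⊨φ = φ▷ψ i i⊨φ
... | no i⊭φ = χ▷ψ i (i⊨φ∨χ i⊭φ)
sound (ax-A2 φ) (node val succ decl) i ()
sound (ax-A3 φ) (node val succ decl) i _ = here ((λ ()) , λ _ j⊨⊤ → j⊨⊤)
sound (mp d e) w = sound d w (sound e w)
sound (rule-M d e) (node val succ decl) φ₂▷ψ₁ i i⊨φ₁ =
  Any.map (Product.map₂ λ entails j j⊨ψ′ → sound e (succ j) (entails j j⊨ψ′))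
          (φ₂▷ψ₁ i (sound d (succ i) i⊨φ₁))

⊭⇒ : ∀ {w} → ¬ w ⊨ φ ⇒ ψ → w ⊨ φ × ¬ w ⊨ ψ
⊭⇒ {φ} {w = w} w⊭φ⇒ψ =
  decidable-stable (w ⊨? φ) (λ w⊭φ → w⊭φ⇒ψ (⊥-elim ∘ w⊭φ)) , λ w⊨ψ → w⊭φ⇒ψ λ _ → w⊨ψ

infix 3 _⊢_

data _⊢_ (Γ : List Fm) : Fm → Set where
  hyp : φ ∈ Γ → Γ ⊢ φ
  thm : ⊢ φ → Γ ⊢ φ
  app : Γ ⊢ φ ⇒ ψ → Γ ⊢ φ → Γ ⊢ ψ

hyp₀ : φ ∷ Γ ⊢ φ
hyp₀ = hyp (here refl)

hyp₁ : ψ ∷ φ ∷ Γ ⊢ φ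
hyp₁ = hyp (there (here refl))

wk : Γ ⊢ φ → ψ ∷ Γ ⊢ φ
wk (hyp φ∈Γ) = hyp (there φ∈Γ)
wk (thm d) = thm d
wk (app d e) = app (wk d) (wk e)

sound-in : ∀ {w} → All (w ⊨_) Γ → Γ ⊢ φ → w ⊨ φ
sound-in w⊨Γ (hyp φ∈Γ) = All.lookup w⊨Γ φ∈Γ
sound-in w⊨Γ (thm d) = sound d _
sound-in w⊨Γ (app d e) = sound-in w⊨Γ d (sound-in w⊨Γ e)

⊢-id : ∀ φ → ⊢ (φ ⇒ φ)
⊢-id φ = mp (mp (ax-S φ (φ ⇒ φ) φ) (ax-K φ (φ ⇒ φ))) (ax-K φ φ)

deduction : φ ∷ Γ ⊢ ψ → Γ ⊢ φ ⇒ ψ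
deduction (hyp (here refl)) = thm (⊢-id _)
deduction (hyp (there ψ∈Γ)) = app (thm (ax-K _ _)) (hyp ψ∈Γ)
deduction (thm d) = app (thm (ax-K _ _)) (thm d)
deduction (app d e) = app (app (thm (ax-S _ _ _)) (deduction d)) (deduction e)

closed : [] ⊢ φ → ⊢ φ
closed (thm d) = d
closed (app d e) = mp (closed d) (closed e)

efq : Γ ⊢ ⊥' → Γ ⊢ φ
efq {φ = φ} d = app (thm (ax-DN φ)) (app (thm (ax-K ⊥' (¬' φ))) d)

excluded-middle : φ ∷ Γ ⊢ ψ → ¬' φ ∷ Γ ⊢ ψ → Γ ⊢ ψ
excluded-middle {φ} {Γ} {ψ} d e = app (thm (ax-DN ψ)) (deduction (app hyp₀ ψ-from-¬ψ))
  where
  ¬φ-from-¬ψ : ¬' ψ ∷ Γ ⊢ ¬' φ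
  ¬φ-from-¬ψ = deduction (app hyp₁ (app (wk (wk (deduction d))) hyp₀))
  ψ-from-¬ψ : ¬' ψ ∷ Γ ⊢ ψ
  ψ-from-¬ψ = app (wk (deduction e)) ¬φ-from-¬ψ

▷-mono : ⊢ (φ₁ ⇒ φ₂) → ⊢ (ψ₁ ⇒ ψ₂) → Γ ⊢ φ₂ ▷ ψ₁ → Γ ⊢ φ₁ ▷ ψ₂
▷-mono d e = app (thm (rule-M d e))

▷-∨ : Γ ⊢ φ ▷ ψ → Γ ⊢ χ ▷ ψ → Γ ⊢ (φ ∨' χ) ▷ ψ
▷-∨ d e = app (app (thm (ax-A1 _ _ _)) d) e

Decides : List Fm → Fm → Set
Decides Γ φ = Γ ⊢ φ ⊎ Γ ⊢ ¬' φ

decides-⇒ : Decides Γ φ → Decides Γ ψ → Decides Γ (φ ⇒ ψ)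
decides-⇒ _ (inj₁ ψ) = inj₁ (app (thm (ax-K _ _)) ψ)
decides-⇒ (inj₂ ¬φ) _ = inj₁ (deduction (efq (app (wk ¬φ) hyp₀)))
decides-⇒ (inj₁ φ) (inj₂ ¬ψ) = inj₂ (deduction (app (wk ¬ψ) (app hyp₀ (wk φ))))

atoms : Fm → List Fm
atoms (var p) = [ var p ]
atoms ⊥' = []
atoms (φ ⇒ ψ) = atoms φ ++ atoms ψ
atoms (φ ▷ ψ) = [ φ ▷ ψ ]

kalmar : ∀ φ → (∀ {c} → c ∈ atoms φ → Decides Γ c) → Decides Γ φ
kalmar (var p) atoms-decided = atoms-decided (here refl)
kalmar ⊥' _ = inj₂ (thm (⊢-id ⊥'))
kalmar (φ ⇒ ψ) atoms-decided =
  decides-⇒ (kalmar φ (atoms-decided ∘ ∈-++⁺ˡ)) (kalmar ψ (atoms-decided ∘ ∈-++⁺ʳ (atoms φ)))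
kalmar (φ ▷ ψ) atoms-decided = atoms-decided (here refl)

by-cases : {P : Fm → Set} {X : Set} (xs : List Fm) → All (λ c → P c × P (¬' c)) xs →
           (∀ Γ → All P Γ → (∀ {c} → c ∈ xs → Decides Γ c) → Γ ⊢ φ ⊎ X) → ⊢ φ ⊎ X
by-cases {φ} {P} {X} xs P-xs leaf = Sum.map₁ closed (go [] [] xs P-xs inj₁)
  where
  go : ∀ Γ → All P Γ → ∀ ys → All (λ c → P c × P (¬' c)) ys →
       (∀ {c} → c ∈ xs → c ∈ ys ⊎ Decides Γ c) → Γ ⊢ φ ⊎ X
  go Γ P-Γ [] _ pending = leaf Γ P-Γ (Sum.[ (λ ()) , id ] ∘ pending)
  go Γ P-Γ (y ∷ ys) ((P-y , P-¬y) ∷ P-ys) pending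
    with go (y ∷ Γ) (P-y ∷ P-Γ) ys P-ys (settle (inj₁ hyp₀))
       | go (¬' y ∷ Γ) (P-¬y ∷ P-Γ) ys P-ys (settle (inj₂ hyp₀))
    where
    settle : ∀ {ℓ} → Decides (ℓ ∷ Γ) y → ∀ {c} → c ∈ xs → c ∈ ys ⊎ Decides (ℓ ∷ Γ) c
    settle y-decided c∈xs with pending c∈xs
    ... | inj₁ (here refl) = inj₂ y-decided
    ... | inj₁ (there c∈ys) = inj₁ c∈ys
    ... | inj₂ c-decided = inj₂ (Sum.map wk wk c-decided)
  ... | inj₁ d | inj₁ e = inj₁ (excluded-middle d e)
  ... | inj₂ x | _ = inj₂ x
  ... | inj₁ _ | inj₂ x = inj₂ x

depth : Fm → ℕ
depth (var _) = 0
depth ⊥' = 0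
depth (φ ⇒ ψ) = depth φ ⊔ depth ψ
depth (φ ▷ ψ) = suc (depth φ ⊔ depth ψ)

⊥-depth : m < n → depth ⊥' < n
⊥-depth (s≤s _) = s≤s z≤n

data Atom (n : ℕ) : Fm → Set where
  atom-var : ∀ p → Atom n (var p)
  atom-▷ : depth φ < n → depth ψ < n → Atom n (φ ▷ ψ)

data Literal (n : ℕ) : Fm → Set where
  pos : Atom n φ → Literal n φ
  neg : Atom n φ → Literal n (¬' φ)

Atom-mono : m ≤ n → Atom m φ → Atom n φ
Atom-mono _ (atom-var p) = atom-var p
Atom-mono m≤n (atom-▷ φ<m ψ<m) = atom-▷ (<-≤-trans φ<m m≤n) (<-≤-trans ψ<m m≤n)

atoms-Atom : ∀ φ → c ∈ atoms φ → Atom (depth φ) c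
atoms-Atom (var p) (here refl) = atom-var p
atoms-Atom (φ ▷ ψ) (here refl) = atom-▷ (s≤s (m≤m⊔n _ _)) (s≤s (m≤n⊔m _ _))
atoms-Atom (φ ⇒ ψ) c∈atoms with ∈-++⁻ (atoms φ) c∈atoms
... | inj₁ c∈φ = Atom-mono (m≤m⊔n _ _) (atoms-Atom φ c∈φ)
... | inj₂ c∈ψ = Atom-mono (m≤n⊔m _ _) (atoms-Atom ψ c∈ψ)

boxesOf : List Fm → List (Fm × Fm)
boxesOf [] = []
boxesOf ((φ ▷ ψ) ∷ Γ) = (φ , ψ) ∷ boxesOf Γ
boxesOf (_ ∷ Γ) = boxesOf Γ

∈-boxesOf⁺ : φ ▷ ψ ∈ Γ → (φ , ψ) ∈ boxesOf Γ
∈-boxesOf⁺ (here refl) = here refl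
∈-boxesOf⁺ {Γ = var _ ∷ _} (there m) = ∈-boxesOf⁺ m
∈-boxesOf⁺ {Γ = ⊥' ∷ _} (there m) = ∈-boxesOf⁺ m
∈-boxesOf⁺ {Γ = _ ⇒ _ ∷ _} (there m) = ∈-boxesOf⁺ m
∈-boxesOf⁺ {Γ = _ ▷ _ ∷ _} (there m) = there (∈-boxesOf⁺ m)

∈-boxesOf⁻ : (φ , ψ) ∈ boxesOf Γ → φ ▷ ψ ∈ Γ
∈-boxesOf⁻ {Γ = var _ ∷ _} m = there (∈-boxesOf⁻ m)
∈-boxesOf⁻ {Γ = ⊥' ∷ _} m = there (∈-boxesOf⁻ m)
∈-boxesOf⁻ {Γ = _ ⇒ _ ∷ _} m = there (∈-boxesOf⁻ m)
∈-boxesOf⁻ {Γ = _ ▷ _ ∷ _} (here refl) = here refl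
∈-boxesOf⁻ {Γ = _ ▷ _ ∷ _} (there m) = there (∈-boxesOf⁻ m)

var-≟ : ∀ p φ → Dec (var p ≡ φ)
var-≟ p (var q) = map′ (cong var) (λ { refl → refl }) (p ≟ q)
var-≟ p ⊥' = no λ ()
var-≟ p (_ ⇒ _) = no λ ()
var-≟ p (_ ▷ _) = no λ ()

_∈ᶠ_ : World → (Fin k → World) → Set
u ∈ᶠ f = ∃ λ j → f j ≡ u

_⊆ᶠ_ : List World → (Fin k → World) → Set
W ⊆ᶠ f = All (_∈ᶠ f) W

⊆ᶠ-lookup : ∀ W → W ⊆ᶠ lookup W
⊆ᶠ-lookup W = All.tabulate λ u∈W → Any.index u∈W , sym (lookup-index u∈W)

Blocked : Fm → Fm → List World → Fm × Fm → Set
Blocked δ ψ C (φ′ , ψ′) = (∀ w → w ⊨ φ′ → w ⊨ δ) ⊎ Any (λ c → ¬ c ⊨ ψ′ ⇒ ψ) C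

▷-refuted : ∀ {val} {succ : Fin k → World} {decl δ d C} →
            d ∈ᶠ succ → C ⊆ᶠ succ → d ⊨ φ → ¬ d ⊨ δ → All (Blocked δ ψ C) ((⊤' , ⊤') ∷ decl) →
            ¬ node val succ decl ⊨ φ ▷ ψ
▷-refuted (i , refl) C⊆succ d⊨φ d⊭δ blocked φ▷ψ with lookupAny blocked (φ▷ψ i d⊨φ)
... | inj₁ φ′⊆δ , d⊨φ′ , _ = d⊭δ (φ′⊆δ _ d⊨φ′)
... | inj₂ some-c-refutes , _ , entails with find some-c-refutes
...   | c , c∈C , c⊭ψ′⇒ψ with All.lookup C⊆succ c∈C
...     | j , refl = c⊭ψ′⇒ψ (entails j)

Decided : Fm → Set
Decided φ = ⊢ φ ⊎ ∃ λ w → ¬ w ⊨ φ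

module Realisation (n : ℕ) (decide< : ∀ φ → depth φ < n → Decided φ) where

  Declared : List Fm → Fm × Fm → Set
  Declared Γ (φ′ , ψ′) = Γ ⊢ φ′ ▷ ψ′ × depth φ′ < n × depth ψ′ < n

  record Cover (Γ : List Fm) (ψ : Fm) (decl : List (Fm × Fm)) : Set where
    field
      δ : Fm
      δ▷ψ : Γ ⊢ δ ▷ ψ
      depth-δ : depth δ < n
      counterexamples : List World
      blocked : All (Blocked δ ψ counterexamples) decl

  open Cover

  cover : ∀ decl → All (Declared Γ) decl → depth ψ < n → Cover Γ ψ decl
  cover [] [] ψ<n = record
    { δ = ⊥' ; δ▷ψ = thm (ax-A2 _) ; depth-δ = ⊥-depth ψ<n ; counterexamples = [] ; blocked = [] }
  cover {ψ = ψ} ((φ′ , ψ′) ∷ decl) ((φ′▷ψ′ , φ′<n , ψ′<n) ∷ declared) ψ<n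
    with cover decl declared ψ<n | decide< (ψ′ ⇒ ψ) (⊔-lub ψ′<n ψ<n)
  ... | rest | inj₁ ⊢ψ′⇒ψ = record
    { δ = φ′ ∨' δ rest
    ; δ▷ψ = ▷-∨ (▷-mono (⊢-id φ′) ⊢ψ′⇒ψ φ′▷ψ′) (δ▷ψ rest)
    ; depth-δ = ⊔-lub (⊔-lub φ′<n (⊥-depth φ′<n)) (depth-δ rest)
    ; counterexamples = counterexamples rest
    ; blocked = inj₁ (λ _ w⊨φ′ w⊭φ′ → ⊥-elim (w⊭φ′ w⊨φ′))
              ∷ All.map (Sum.map₁ λ φ″⊆δ w w⊨φ″ _ → φ″⊆δ w w⊨φ″) (blocked rest)
    }
  ... | rest | inj₂ (c , c⊭ψ′⇒ψ) = record
    { δ = δ rest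
    ; δ▷ψ = δ▷ψ rest
    ; depth-δ = depth-δ rest
    ; counterexamples = c ∷ counterexamples rest
    ; blocked = inj₂ (here c⊭ψ′⇒ψ) ∷ All.map (Sum.map₂ there) (blocked rest)
    }

  module _ {Γ : List Fm} (literals : All (Literal n) Γ) where

    var∈? : ∀ p → Dec (var p ∈ Γ)
    var∈? p = any? (var-≟ p) Γ

    val : ℕ → Bool
    val p = ⌊ var∈? p ⌋

    Forces : List World → Fm → Set
    Forces W φ = ∀ {k} (succ : Fin k → World) → W ⊆ᶠ succ → node val succ (boxesOf Γ) ⊨ φ

    declared : All (Declared Γ) (boxesOf Γ)
    declared = All.tabulate λ {(φ , ψ)} m →
      let φ▷ψ∈Γ = ∈-boxesOf⁻ m in hyp φ▷ψ∈Γ , depths (All.lookup literals φ▷ψ∈Γ)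
      where
      depths : Literal n (φ ▷ ψ) → depth φ < n × depth ψ < n
      depths (pos (atom-▷ φ<n ψ<n)) = φ<n , ψ<n

    refute : depth φ < n → depth ψ < n → Γ ⊢ ¬' (φ ▷ ψ) → Γ ⊢ ⊥' ⊎ ∃ λ W → Forces W (¬' (φ ▷ ψ))
    refute {φ} {ψ} φ<n ψ<n ¬φ▷ψ = from-cover (cover _ declared⊤ ψ<n)
      where
      declared⊤ : All (Declared Γ) ((⊤' , ⊤') ∷ boxesOf Γ)
      declared⊤ = (thm (ax-A3 ⊤') , ⊥-depth ψ<n , ⊥-depth ψ<n) ∷ declared
      from-cover : Cover Γ ψ ((⊤' , ⊤') ∷ boxesOf Γ) → Γ ⊢ ⊥' ⊎ ∃ λ W → Forces W (¬' (φ ▷ ψ))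
      from-cover cov with decide< (φ ⇒ δ cov) (⊔-lub φ<n (depth-δ cov))
      ... | inj₁ ⊢φ⇒δ = inj₁ (app ¬φ▷ψ (▷-mono ⊢φ⇒δ (⊢-id ψ) (δ▷ψ cov)))
      ... | inj₂ (d , d⊭φ⇒δ) with ⊭⇒ {φ} {δ cov} d⊭φ⇒δ
      ...   | d⊨φ , d⊭δ = inj₂ (d ∷ counterexamples cov , λ where
        _ (d∈succ ∷ C⊆succ) →
          ▷-refuted {φ = φ} {ψ = ψ} {val = val} {δ = δ cov} d∈succ C⊆succ d⊨φ d⊭δ (blocked cov))

    force : Literal n φ → φ ∈ Γ → Γ ⊢ ⊥' ⊎ ∃ λ W → Forces W φ
    force (pos (atom-var p)) p∈Γ = inj₂ ([] , λ _ _ → fromWitness p∈Γ)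
    force (neg (atom-var p)) ¬p∈Γ with var∈? p
    ... | yes p∈Γ = inj₁ (app (hyp ¬p∈Γ) (hyp p∈Γ))
    ... | no _ = inj₂ ([] , λ _ _ ())
    force (pos (atom-▷ _ _)) φ▷ψ∈Γ =
      inj₂ ([] , λ _ _ i i⊨φ →
        there (Any.map (λ { refl → i⊨φ , λ _ j⊨ψ → j⊨ψ }) (∈-boxesOf⁺ φ▷ψ∈Γ)))
    force (neg (atom-▷ φ<n ψ<n)) ¬φ▷ψ∈Γ = refute φ<n ψ<n (hyp ¬φ▷ψ∈Γ)

    forceAll : ∀ {Δ} → All (λ φ → Γ ⊢ ⊥' ⊎ ∃ λ W → Forces W φ) Δ →
               Γ ⊢ ⊥' ⊎ ∃ λ W → All (Forces W) Δ
    forceAll [] = inj₂ ([] , [])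
    forceAll (inj₁ inconsistent ∷ _) = inj₁ inconsistent
    forceAll (inj₂ (W , forced) ∷ rest) with forceAll rest
    ... | inj₁ inconsistent = inj₁ inconsistent
    ... | inj₂ (W′ , forced′) =
      inj₂ (W ++ W′ , (λ {_} succ → forced succ ∘ ++⁻ˡ W)
                    ∷ All.map (λ forced″ {_} succ → forced″ succ ∘ ++⁻ʳ W) forced′)

    realise : Γ ⊢ ⊥' ⊎ ∃ λ w → All (w ⊨_) Γ
    realise = Sum.map₂ model (forceAll (All.tabulate λ φ∈Γ → force (All.lookup literals φ∈Γ) φ∈Γ))
      where
      model : (∃ λ W → All (Forces W) Γ) → ∃ λ w → All (w ⊨_) Γ
      model (W , forced) =
        node val (lookup W) (boxesOf Γ) , All.map (λ f → f (lookup W) (⊆ᶠ-lookup W)) forced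

decide-step : ∀ φ → (∀ ψ → depth ψ < depth φ → Decided ψ) → Decided φ
decide-step φ decide< = by-cases (atoms φ) (All.tabulate atom-literals) leaf
  where
  open Realisation (depth φ) decide<
  atom-literals : c ∈ atoms φ → Literal (depth φ) c × Literal (depth φ) (¬' c)
  atom-literals c∈atoms = pos (atoms-Atom φ c∈atoms) , neg (atoms-Atom φ c∈atoms)
  leaf : ∀ Γ → All (Literal (depth φ)) Γ → (∀ {c} → c ∈ atoms φ → Decides Γ c) →
         Γ ⊢ φ ⊎ ∃ λ w → ¬ w ⊨ φ
  leaf Γ literals atoms-decided with kalmar φ atoms-decided
  ... | inj₁ Γ⊢φ = inj₁ Γ⊢φ
  ... | inj₂ Γ⊢¬φ = Sum.map efq (λ (w , w⊨Γ) → w , sound-in w⊨Γ Γ⊢¬φ) (realise literals)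

decide-below : ∀ n φ → depth φ < n → Decided φ
decide-below (suc n) φ (s≤s φ≤n) = decide-step φ λ ψ ψ<φ → decide-below n ψ (<-≤-trans ψ<φ φ≤n)

decided : ∀ φ → Decided φ
decided φ = decide-below (suc (depth φ)) φ ≤-refl

corollary1 : (φ : Fm) → Dec (⊢ φ)
corollary1 φ with decided φ
... | inj₁ ⊢φ = yes ⊢φ
... | inj₂ (w , w⊭φ) = no λ ⊢φ → w⊭φ (sound ⊢φ w)
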